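{- Let $n\geq 2$ and $1\leq k<n$ be integers, let $e=\gcd(k,n)$, and assume $n/e$ is odd. Let $q=2^n$ and let $F:\mathbb{F}_{q}\to\mathbb{F}_q$, $F(x)=x^{2^k+1}$. Then for every $b\in\mathbb{F}_q^*$, the $1$-boomerang connectivity table entry ${}_1\mathcal{B}_F(1,b)$ equals $0$ if $\mathrm{Tr}_e\left(b^{1/2}\right)=0$, and equals $2^e$ if $\mathrm{Tr}_e\left(b^{1/2}\right)\neq 0$.
   Context: For $c\in\mathbb{F}_q^*$ and $a,b\in\mathbb{F}_q$, the $c$-boomerang connectivity table ($c$-BCT) entry ${}_c\mathcal{B}_F(a,b)$ is the number of pairs $(x,y)\in\mathbb{F}_q\times\mathbb{F}_q$ satisfying simultaneously $F(x)+cF(y)=b$ and $F(x+a)+c^{ -1}F(y+a)=b$ (characteristic $2$). For $e\mid n$, $\mathrm{Tr}_e:\mathbb{F}_{2^n}\to\mathbb{F}_{2^e}$ is the relative trace $\mathrm{Tr}_e(z)=\sum_{i=0}^{n/e-1} z^{2^{ie}}$. $b^{1/2}$ denotes the unique square root of $b$ in $\mathbb{F}_q$. -}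

module Defs where

open import Level using (0ℓ)
open import Data.Nat as ℕ using (ℕ; zero; suc)
open import Data.List using (List; length; filter; cartesianProduct; foldr; map; upTo)
open import Data.List.Membership.Propositional using (_∈_)
open import Data.List.Relation.Unary.Unique.Propositional using (Unique)
open import Data.Product using (_×_; _,_; ∃)
open import Relation.Nullary using (¬_; Dec)
open import Relation.Nullary.Decidable using (_×-dec_)
open import Relation.Binary.PropositionalEquality using (_≡_)
open import Algebra.Structures using (IsCommutativeRing)

-- A finite field with exactly 2^n elements (equality is propositional).
-- All such fields are isomorphic, so this is the field 𝔽_{2^n}.
record FiniteField (n : ℕ) : Set₁ where
  infixl 6 _+_
  infixl 7 _*_
  field
    Carrier : Set
    _+_ _*_ : Carrier → Carrier → Carrier
    -_ : Carrier → Carrier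
    0# 1# : Carrier
    isCommutativeRing : IsCommutativeRing _≡_ _+_ _*_ -_ 0# 1#
    0≢1 : ¬ (0# ≡ 1#)
    inverse : ∀ x → ¬ (x ≡ 0#) → ∃ λ y → x * y ≡ 1#
    _≟_ : (x y : Carrier) → Dec (x ≡ y)
    elements : List Carrier
    complete : ∀ x → x ∈ elements
    unique : Unique elements
    card : length elements ≡ 2 ℕ.^ n

module _ {n : ℕ} (𝔽 : FiniteField n) where
  open FiniteField 𝔽

  pow : Carrier → ℕ → Carrier
  pow x zero = 1#
  pow x (suc m) = x * pow x m

  -- Relative trace Tr_e : 𝔽_{2^n} → 𝔽_{2^e}, where d = n / e:
  -- Tr_e(z) = Σ_{i=0}^{d-1} z^{2^{i e}}
  relTrace : (e d : ℕ) → Carrier → Carrier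
  relTrace e d z = foldr _+_ 0# (map (λ i → pow z (2 ℕ.^ (i ℕ.* e))) (upTo d))

  -- c-BCT entry (characteristic 2), with c⁻¹ passed as cinv (c * cinv ≡ 1):
  -- number of pairs (x,y) with F(x) + c F(y) = b and F(x+a) + c⁻¹ F(y+a) = b.
  cBCT : (F : Carrier → Carrier) (c cinv a b : Carrier) → ℕ
  cBCT F c cinv a b =
    length (filter (λ { (x , y) → ((F x + c * F y) ≟ b) ×-dec ((F (x + a) + cinv * F (y + a)) ≟ b) })
                   (cartesianProduct elements elements))

{-# OPTIONS --safe #-}

-- Put u = x + y. Since F x + F (x + u) = x^{2^k} u + u^{2^k} x + u^{2^k+1} =: Δ x u and
-- Δ (x + 1) u = Δ x u + u + u^{2^k}, the two equations say Δ x u = b and u^{2^k} = u.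
-- By Bézout, u^{2^k} = u forces u ∈ 𝔽_{2^e}, and then b = u (L x + u) with L x = x^{2^k} + x.
-- Applying Tr_e, which kills L x and (n/e being odd) fixes u, gives Tr_e(b) = u², so
-- u = Tr_e(b^{1/2}) =: t. Hence there is no solution when t = 0; otherwise the solutions are
-- the pairs (x, x + t) with L x = b/t + t. The right-hand side has trace 0, so this equation
-- is solvable (explicitly, via the even conjugates of b/t + t), and its solutions form a coset
-- of ker L = 𝔽_{2^e}. That field has 2^e elements: at most 2^e as roots of x^{2^e} + x, and
-- at least 2^e since Tr_e maps 𝔽_{2^n} into it with fibres of size at most 2^{n-e}.

module Submission where

open import Defs
open import Level using (Level)
open import Algebra.Bundles using (CommutativeRing; RawRing)
open import Algebra.Structures using (IsCommutativeRing)
import Algebra.Properties.CommutativeSemigroup as CommutativeSemigroupProperties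
import Algebra.Properties.Group as GroupProperties
open import Algebra.Solver.Ring.AlmostCommutativeRing using (fromCommutativeRing; _-Raw-AlmostCommutative⟶_)
open import Data.Bool using (Bool; true; false; _xor_; _∧_)
import Data.Bool.Properties as Bool
open import Data.Empty using (⊥-elim)
open import Data.List using (List; []; _∷_; length; filter; map; foldr; replicate; applyUpTo; _++_; cartesianProduct)
open import Data.List.Properties using (map-applyUpTo; length-replicate; length-map; length-++; filter-++; filter-≐; filter-none)
open import Data.List.Membership.Propositional using (_∈_)
open import Data.List.Membership.Propositional.Properties using (∈-filter⁺; ∈-filter⁻; ∈-map⁺; ∈-map⁻)
open import Data.List.Membership.Propositional.Properties.WithK using (unique∧set⇒bag)
open import Data.List.Relation.Binary.BagAndSetEquality using (∼bag⇒↭)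
open import Data.List.Relation.Binary.Permutation.Propositional using (_↭_; ↭⇒↭ₛ)
open import Data.List.Relation.Binary.Permutation.Propositional.Properties using (↭-length)
import Data.List.Relation.Binary.Permutation.Setoid.Properties as Perm
open import Data.List.Relation.Unary.All as All using (All)
open import Data.List.Relation.Unary.AllPairs using ([]; _∷_)
open import Data.List.Relation.Unary.Any using (here; there)
open import Data.List.Relation.Unary.Unique.Propositional using (Unique)
open import Data.List.Relation.Unary.Unique.Propositional.Properties using (filter⁺; map⁺)
import Data.Maybe as Maybe
open import Data.Nat as ℕ using (ℕ; zero; suc; z≤n; s≤s; _≤_; _<_; _%_; _/_)
import Data.Nat.Properties as ℕ
open import Data.Nat.DivMod using (m≡m%n+[m/n]*n)
open import Data.Nat.Divisibility using (_∣_)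
open import Data.Nat.GCD using (gcd; gcd[m,n]∣m; gcd[m,n]≢0; gcd-GCD; module Bézout)
open Bézout.Identity using (Identity; +-; -+)
open import Data.Nat.ListAction using (sum)
open import Data.Product using (Σ; ∃; _×_; _,_; proj₁; proj₂)
open import Data.Sum using (_⊎_; inj₁; inj₂)
open import Function using (_∘_)
open import Function.Bundles using (mk⇔)
open import Relation.Binary.Definitions using (DecidableEquality)
open import Relation.Binary.PropositionalEquality
open import Relation.Nullary using (¬_; Dec; yes; no; ¬?)
open import Relation.Nullary.Decidable using (dec⇒maybe)
open import Relation.Unary using (Pred; Decidable)

module _ {a : Level} {A : Set a} where

  unique-sameMembers⇒↭ : {xs ys : List A} → Unique xs → Unique ys →
                         (∀ {z} → z ∈ xs → z ∈ ys) → (∀ {z} → z ∈ ys → z ∈ xs) → xs ↭ ys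
  unique-sameMembers⇒↭ xs! ys! xs⊆ys ys⊆xs = ∼bag⇒↭ (unique∧set⇒bag xs! ys! (mk⇔ xs⊆ys ys⊆xs))

  length-filter-+-∁ : ∀ {p} {P : Pred A p} (P? : Decidable P) xs →
                      length (filter P? xs) ℕ.+ length (filter (¬? ∘ P?) xs) ≡ length xs
  length-filter-+-∁ P? [] = refl
  length-filter-+-∁ P? (x ∷ xs) with P? x
  ... | yes _ = cong suc (length-filter-+-∁ P? xs)
  ... | no _ = trans (ℕ.+-suc _ _) (cong suc (length-filter-+-∁ P? xs))

  module _ (_≟_ : DecidableEquality A) {xs : List A} (xs! : Unique xs) (xs-complete : ∀ x → x ∈ xs) where

    length-filter-≟-complete : ∀ a → length (filter (_≟ a) xs) ≡ 1
    length-filter-≟-complete a = ↭-length (unique-sameMembers⇒↭ (filter⁺ (_≟ a) xs!) (All.[] ∷ [])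
      (λ x∈ → here (proj₂ (∈-filter⁻ (_≟ a) {xs = xs} x∈)))
      (λ { (here refl) → ∈-filter⁺ (_≟ a) (xs-complete a) refl }))

  length-filter-involution : ∀ {p} {P : Pred A p} (P? : Decidable P) {f : A → A} → (∀ x → f (f x) ≡ x) →
                             ∀ {xs} → Unique xs → (∀ x → x ∈ xs) →
                             length (filter P? xs) ≡ length (filter (P? ∘ f) xs)
  length-filter-involution {P = P} P? {f} f-inv {xs} xs! xs-complete = begin
    length (filter P? xs)              ≡⟨ ↭-length (unique-sameMembers⇒↭ (filter⁺ P? xs!) (map⁺ f-injective (filter⁺ (P? ∘ f) xs!)) ⊆ ⊇) ⟩
    length (map f (filter (P? ∘ f) xs)) ≡⟨ length-map f (filter (P? ∘ f) xs) ⟩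
    length (filter (P? ∘ f) xs)        ∎
    where
    open ≡-Reasoning
    f-injective : ∀ {x y} → f x ≡ f y → x ≡ y
    f-injective {x} {y} fx≡fy = trans (sym (f-inv x)) (trans (cong f fx≡fy) (f-inv y))
    ⊆ : ∀ {z} → z ∈ filter P? xs → z ∈ map f (filter (P? ∘ f) xs)
    ⊆ {z} z∈ = subst (_∈ map f (filter (P? ∘ f) xs)) (f-inv z)
      (∈-map⁺ f (∈-filter⁺ (P? ∘ f) (xs-complete (f z)) (subst P (sym (f-inv z)) (proj₂ (∈-filter⁻ P? {xs = xs} z∈)))))
    ⊇ : ∀ {z} → z ∈ map f (filter (P? ∘ f) xs) → z ∈ filter P? xs
    ⊇ {z} z∈ with ∈-map⁻ f z∈
    ... | w , w∈ , refl = ∈-filter⁺ P? (xs-complete (f w)) (proj₂ (∈-filter⁻ (P? ∘ f) {xs = xs} w∈))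

length-filter-map : ∀ {a b p} {A : Set a} {B : Set b} {P : Pred A p} (P? : Decidable P) (f : B → A) ys →
                    length (filter P? (map f ys)) ≡ length (filter (P? ∘ f) ys)
length-filter-map P? f [] = refl
length-filter-map P? f (y ∷ ys) with P? (f y)
... | yes _ = cong suc (length-filter-map P? f ys)
... | no _ = length-filter-map P? f ys

module _ {a : Level} {A : Set a} (_≟_ : DecidableEquality A) {ys : List A} (ys! : Unique ys) (ys-complete : ∀ y → y ∈ ys) where

  length-filter-cartesianProduct-graph :
    ∀ {p q} {P : Pred (A × A) p} (P? : Decidable P) {Q : Pred A q} (Q? : Decidable Q) (h : A → A) →
    (∀ {x y} → P (x , y) → y ≡ h x × Q x) → (∀ {x} → Q x → P (x , h x)) →
    ∀ xs → length (filter P? (cartesianProduct xs ys)) ≡ length (filter Q? xs)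
  length-filter-cartesianProduct-graph P? Q? h P⇒ ⇒P [] = refl
  length-filter-cartesianProduct-graph {P = P} P? {Q} Q? h P⇒ ⇒P (x ∷ xs) = begin
    length (filter P? (map (x ,_) ys ++ cartesianProduct xs ys))
      ≡⟨ trans (cong length (filter-++ P? (map (x ,_) ys) _)) (length-++ (filter P? (map (x ,_) ys))) ⟩
    length (filter P? (map (x ,_) ys)) ℕ.+ length (filter P? (cartesianProduct xs ys))
      ≡⟨ cong₂ ℕ._+_ (length-filter-map P? (x ,_) ys) (length-filter-cartesianProduct-graph P? Q? h P⇒ ⇒P xs) ⟩
    length (filter (P? ∘ (x ,_)) ys) ℕ.+ length (filter Q? xs)
      ≡⟨ row (Q? x) ⟩
    length (filter Q? (x ∷ xs)) ∎
    where
    open ≡-Reasoning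
    row : Dec (Q x) → length (filter (P? ∘ (x ,_)) ys) ℕ.+ length (filter Q? xs) ≡ length (filter Q? (x ∷ xs))
    row (yes Qx) with Q? x
    ... | no ¬Qx = ⊥-elim (¬Qx Qx)
    ... | yes _ = cong (ℕ._+ length (filter Q? xs))
      (trans (cong length (filter-≐ (P? ∘ (x ,_)) (_≟ h x) ((proj₁ ∘ P⇒) , λ { refl → ⇒P Qx }) ys))
             (length-filter-≟-complete _≟_ ys! ys-complete (h x)))
    row (no ¬Qx) with Q? x
    ... | yes Qx = ⊥-elim (¬Qx Qx)
    ... | no _ = cong (λ zs → length zs ℕ.+ length (filter Q? xs))
      (filter-none (P? ∘ (x ,_)) (All.universal (λ y → ¬Qx ∘ proj₂ ∘ P⇒) ys))

module _ {a b : Level} {A : Set a} {B : Set b} (_≟_ : DecidableEquality B) (f : A → B) where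

  fibreSize : List A → B → ℕ
  fibreSize xs s = length (filter (λ x → f x ≟ s) xs)

  private
    fibreSize-∷ : ∀ x xs s → fibreSize xs s ≤ fibreSize (x ∷ xs) s
    fibreSize-∷ x xs s with f x ≟ s
    ... | yes _ = ℕ.n≤1+n _
    ... | no _ = ℕ.≤-refl

    sum-map-mono : ∀ {g g' : B → ℕ} S → (∀ s → g s ≤ g' s) → sum (map g S) ≤ sum (map g' S)
    sum-map-mono [] g≤g' = z≤n
    sum-map-mono (s ∷ S) g≤g' = ℕ.+-mono-≤ (g≤g' s) (sum-map-mono S g≤g')

    fibreSizes-∷ : ∀ x xs {S} → f x ∈ S → suc (sum (map (fibreSize xs) S)) ≤ sum (map (fibreSize (x ∷ xs)) S)
    fibreSizes-∷ x xs {s ∷ S} (here refl) with f x ≟ s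
    ... | yes _ = s≤s (ℕ.+-monoʳ-≤ (fibreSize xs s) (sum-map-mono S (fibreSize-∷ x xs)))
    ... | no fx≢fx = ⊥-elim (fx≢fx refl)
    fibreSizes-∷ x xs {s ∷ S} (there fx∈S) = ℕ.≤-trans (ℕ.≤-reflexive (sym (ℕ.+-suc (fibreSize xs s) _)))
      (ℕ.+-mono-≤ (fibreSize-∷ x xs s) (fibreSizes-∷ x xs fx∈S))

    length-≤-sum-fibreSizes : ∀ xs S → (∀ x → f x ∈ S) → length xs ≤ sum (map (fibreSize xs) S)
    length-≤-sum-fibreSizes [] S f∈S = z≤n
    length-≤-sum-fibreSizes (x ∷ xs) S f∈S = ℕ.≤-trans (s≤s (length-≤-sum-fibreSizes xs S f∈S)) (fibreSizes-∷ x xs (f∈S x))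

    sum-map-≤ : ∀ {g : B → ℕ} {N} S → (∀ s → g s ≤ N) → sum (map g S) ≤ length S ℕ.* N
    sum-map-≤ [] g≤N = z≤n
    sum-map-≤ (s ∷ S) g≤N = ℕ.+-mono-≤ (g≤N s) (sum-map-≤ S g≤N)

  length-≤-image×fibreSize : ∀ xs S {N} → (∀ x → f x ∈ S) → (∀ s → fibreSize xs s ≤ N) → length xs ≤ length S ℕ.* N
  length-≤-image×fibreSize xs S f∈S fibre≤N = ℕ.≤-trans (length-≤-sum-fibreSizes xs S f∈S) (sum-map-≤ S fibre≤N)

module FieldFacts {n : ℕ} (𝔽 : FiniteField n) where
  open FiniteField 𝔽 public
  open IsCommutativeRing isCommutativeRing public
    using (+-assoc; +-comm; *-assoc; *-comm; +-identityˡ; +-identityʳ; *-identityˡ; *-identityʳ;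
           distribˡ; distribʳ; zeroˡ; zeroʳ; -‿inverseʳ)
  open IsCommutativeRing isCommutativeRing using (+-isCommutativeMonoid; *-isCommutativeMonoid)
  open ≡-Reasoning

  ring : CommutativeRing _ _
  ring = record { isCommutativeRing = isCommutativeRing }

  open GroupProperties (CommutativeRing.+-group ring) using () renaming (∙-cancelˡ to +-cancelˡ; ∙-cancelʳ to +-cancelʳ)
  open CommutativeSemigroupProperties (CommutativeRing.*-commutativeSemigroup ring) using ()
    renaming (interchange to *-interchange)
  open CommutativeSemigroupProperties (CommutativeRing.+-commutativeSemigroup ring) using ()
    renaming (interchange to +-interchange)

  1≢0 : 1# ≢ 0#
  1≢0 = 0≢1 ∘ sym

  *-cancelˡ : ∀ {x y} a → a ≢ 0# → a * x ≡ a * y → x ≡ y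
  *-cancelˡ {x} {y} a a≢0 ax≡ay with inverse a a≢0
  ... | a⁻¹ , aa⁻¹≡1 = begin
    x              ≡⟨ sym (*-identityˡ x) ⟩
    1# * x         ≡⟨ cong (_* x) (trans (sym aa⁻¹≡1) (*-comm a a⁻¹)) ⟩
    (a⁻¹ * a) * x  ≡⟨ *-assoc a⁻¹ a x ⟩
    a⁻¹ * (a * x)  ≡⟨ cong (a⁻¹ *_) ax≡ay ⟩
    a⁻¹ * (a * y)  ≡⟨ sym (*-assoc a⁻¹ a y) ⟩
    (a⁻¹ * a) * y  ≡⟨ cong (_* y) (trans (*-comm a⁻¹ a) aa⁻¹≡1) ⟩
    1# * y         ≡⟨ *-identityˡ y ⟩
    y              ∎

  x*y≡0⇒x≡0⊎y≡0 : ∀ {x y} → x * y ≡ 0# → x ≡ 0# ⊎ y ≡ 0#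
  x*y≡0⇒x≡0⊎y≡0 {x} {y} xy≡0 with x ≟ 0#
  ... | yes x≡0 = inj₁ x≡0
  ... | no x≢0 = inj₂ (*-cancelˡ x x≢0 (trans xy≡0 (sym (zeroʳ x))))

  x≢0∧y≢0⇒x*y≢0 : ∀ {x y} → x ≢ 0# → y ≢ 0# → x * y ≢ 0#
  x≢0∧y≢0⇒x*y≢0 x≢0 y≢0 xy≡0 with x*y≡0⇒x≡0⊎y≡0 xy≡0
  ... | inj₁ x≡0 = x≢0 x≡0
  ... | inj₂ y≡0 = y≢0 y≡0

  pow-+ : ∀ x i j → pow 𝔽 x (i ℕ.+ j) ≡ pow 𝔽 x i * pow 𝔽 x j
  pow-+ x zero j = sym (*-identityˡ _)
  pow-+ x (suc i) j = trans (cong (x *_) (pow-+ x i j)) (sym (*-assoc x _ _))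

  pow-* : ∀ x i j → pow 𝔽 x (i ℕ.* j) ≡ pow 𝔽 (pow 𝔽 x i) j
  pow-* x i zero = cong (pow 𝔽 x) (ℕ.*-zeroʳ i)
  pow-* x i (suc j) = begin
    pow 𝔽 x (i ℕ.* suc j)                ≡⟨ cong (pow 𝔽 x) (ℕ.*-suc i j) ⟩
    pow 𝔽 x (i ℕ.+ i ℕ.* j)              ≡⟨ pow-+ x i (i ℕ.* j) ⟩
    pow 𝔽 x i * pow 𝔽 x (i ℕ.* j)        ≡⟨ cong (pow 𝔽 x i *_) (pow-* x i j) ⟩
    pow 𝔽 x i * pow 𝔽 (pow 𝔽 x i) j      ∎

  pow-distrib-* : ∀ x y i → pow 𝔽 (x * y) i ≡ pow 𝔽 x i * pow 𝔽 y i
  pow-distrib-* x y zero = sym (*-identityˡ 1#)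
  pow-distrib-* x y (suc i) = trans (cong ((x * y) *_) (pow-distrib-* x y i)) (*-interchange x y _ _)

  pow-1# : ∀ i → pow 𝔽 1# i ≡ 1#
  pow-1# zero = refl
  pow-1# (suc i) = trans (*-identityˡ _) (pow-1# i)

  pow≡0⇒≡0 : ∀ x i → pow 𝔽 x i ≡ 0# → x ≡ 0#
  pow≡0⇒≡0 x zero 1≡0 = ⊥-elim (1≢0 1≡0)
  pow≡0⇒≡0 x (suc i) xxⁱ≡0 with x*y≡0⇒x≡0⊎y≡0 xxⁱ≡0
  ... | inj₁ x≡0 = x≡0
  ... | inj₂ xⁱ≡0 = pow≡0⇒≡0 x i xⁱ≡0

  fromℕ : ℕ → Carrier
  fromℕ zero = 0#
  fromℕ (suc m) = 1# + fromℕ m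

  fromℕ-+ : ∀ i j → fromℕ (i ℕ.+ j) ≡ fromℕ i + fromℕ j
  fromℕ-+ zero j = sym (+-identityˡ _)
  fromℕ-+ (suc i) j = trans (cong (1# +_) (fromℕ-+ i j)) (sym (+-assoc 1# _ _))

  fromℕ-* : ∀ i j → fromℕ (i ℕ.* j) ≡ fromℕ i * fromℕ j
  fromℕ-* zero j = sym (zeroˡ _)
  fromℕ-* (suc i) j = begin
    fromℕ (j ℕ.+ i ℕ.* j)              ≡⟨ trans (fromℕ-+ j (i ℕ.* j)) (cong (fromℕ j +_) (fromℕ-* i j)) ⟩
    fromℕ j + fromℕ i * fromℕ j        ≡⟨ cong (_+ fromℕ i * fromℕ j) (sym (*-identityˡ (fromℕ j))) ⟩
    1# * fromℕ j + fromℕ i * fromℕ j   ≡⟨ sym (distribʳ (fromℕ j) 1# (fromℕ i)) ⟩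
    (1# + fromℕ i) * fromℕ j           ∎

  fromℕ-2^ : ∀ i → fromℕ (2 ℕ.^ i) ≡ pow 𝔽 (1# + 1#) i
  fromℕ-2^ zero = +-identityʳ 1#
  fromℕ-2^ (suc i) = trans (fromℕ-* 2 (2 ℕ.^ i)) (cong₂ _*_ (cong (1# +_) (+-identityʳ 1#)) (fromℕ-2^ i))

  private
    ∑ : List Carrier → Carrier
    ∑ = foldr _+_ 0#

    ∑-map-+1# : ∀ xs → ∑ (map (_+ 1#) xs) ≡ ∑ xs + fromℕ (length xs)
    ∑-map-+1# [] = sym (+-identityʳ 0#)
    ∑-map-+1# (x ∷ xs) = trans (cong ((x + 1#) +_) (∑-map-+1# xs)) (+-interchange x 1# _ _)

    map-+1#-↭ : map (_+ 1#) elements ↭ elements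
    map-+1#-↭ = unique-sameMembers⇒↭ (map⁺ (+-cancelʳ 1# _ _) unique) unique (λ _ → complete _)
      (λ {z} _ → subst (_∈ map (_+ 1#) elements) (-1#+1# z) (∈-map⁺ (_+ 1#) (complete (z + - 1#))))
      where
      -1#+1# : ∀ z → (z + - 1#) + 1# ≡ z
      -1#+1# z = trans (+-assoc z (- 1#) 1#) (trans (cong (z +_) (trans (+-comm (- 1#) 1#) (-‿inverseʳ 1#))) (+-identityʳ z))

  -- The sum of all elements is invariant under x ↦ x + 1, which adds |𝔽| · 1 to it.
  characteristic-2 : 1# + 1# ≡ 0#
  characteristic-2 = pow≡0⇒≡0 (1# + 1#) n (begin
    pow 𝔽 (1# + 1#) n        ≡⟨ sym (fromℕ-2^ n) ⟩
    fromℕ (2 ℕ.^ n)          ≡⟨ cong fromℕ (sym card) ⟩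
    fromℕ (length elements)  ≡⟨ +-cancelˡ (∑ elements) _ _ (begin
      ∑ elements + fromℕ (length elements) ≡⟨ sym (∑-map-+1# elements) ⟩
      ∑ (map (_+ 1#) elements)             ≡⟨ Perm.foldr-commMonoid (setoid Carrier) +-isCommutativeMonoid (↭⇒↭ₛ map-+1#-↭) ⟩
      ∑ elements                           ≡⟨ sym (+-identityʳ _) ⟩
      ∑ elements + 0#                      ∎) ⟩
    0#                       ∎)

  𝔽₂ : RawRing _ _
  𝔽₂ = record { Carrier = Bool ; _≈_ = _≡_ ; _+_ = _xor_ ; _*_ = _∧_ ; -_ = λ b → b ; 0# = false ; 1# = true }

  ⟦_⟧₂ : Bool → Carrier
  ⟦ false ⟧₂ = 0#
  ⟦ true ⟧₂ = 1#

  𝔽₂⟶𝔽 : 𝔽₂ -Raw-AlmostCommutative⟶ fromCommutativeRing ring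
  𝔽₂⟶𝔽 = record { ⟦_⟧ = ⟦_⟧₂ ; +-homo = +-homo ; *-homo = *-homo ; -‿homo = -‿homo ; 0-homo = refl ; 1-homo = refl }
    where
    +-homo : ∀ a b → ⟦ a xor b ⟧₂ ≡ ⟦ a ⟧₂ + ⟦ b ⟧₂
    +-homo false b = sym (+-identityˡ _)
    +-homo true false = sym (+-identityʳ 1#)
    +-homo true true = sym characteristic-2
    *-homo : ∀ a b → ⟦ a ∧ b ⟧₂ ≡ ⟦ a ⟧₂ * ⟦ b ⟧₂
    *-homo false b = sym (zeroˡ _)
    *-homo true b = sym (*-identityˡ _)
    -‿homo : ∀ a → ⟦ a ⟧₂ ≡ - ⟦ a ⟧₂
    -‿homo false = trans (sym (-‿inverseʳ 0#)) (+-identityˡ _)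
    -‿homo true = begin
      1#               ≡⟨ sym (+-identityʳ 1#) ⟩
      1# + 0#          ≡⟨ cong (1# +_) (sym (-‿inverseʳ 1#)) ⟩
      1# + (1# + - 1#) ≡⟨ sym (+-assoc 1# 1# (- 1#)) ⟩
      (1# + 1#) + - 1# ≡⟨ cong (_+ - 1#) characteristic-2 ⟩
      0# + - 1#        ≡⟨ +-identityˡ (- 1#) ⟩
      - 1#             ∎

  open import Algebra.Solver.Ring 𝔽₂ (fromCommutativeRing ring) 𝔽₂⟶𝔽
    (λ a b → Maybe.map (cong ⟦_⟧₂) (dec⇒maybe (a Bool.≟ b))) public
    using (solve; _:=_; _:+_; _:*_; con)

  x+x≡0 : ∀ x → x + x ≡ 0#
  x+x≡0 = solve 1 (λ x → x :+ x := con false) refl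

  x+y≡0⇒x≡y : ∀ {x y} → x + y ≡ 0# → x ≡ y
  x+y≡0⇒x≡y {x} {y} x+y≡0 = begin
    x             ≡⟨ solve 2 (λ x y → x := (x :+ y) :+ y) refl x y ⟩
    (x + y) + y   ≡⟨ cong (_+ y) x+y≡0 ⟩
    0# + y        ≡⟨ +-identityˡ y ⟩
    y             ∎

  square-+ : ∀ x y → (x + y) * (x + y) ≡ x * x + y * y
  square-+ = solve 2 (λ x y → (x :+ y) :* (x :+ y) := x :* x :+ y :* y) refl

  square-injective : ∀ {x y} → x * x ≡ y * y → x ≡ y
  square-injective {x} {y} x²≡y² = x+y≡0⇒x≡y (pow≡0⇒≡0 (x + y) 2 (begin
    (x + y) * ((x + y) * 1#) ≡⟨ cong ((x + y) *_) (*-identityʳ _) ⟩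
    (x + y) * (x + y)        ≡⟨ square-+ x y ⟩
    x * x + y * y            ≡⟨ cong (_+ y * y) x²≡y² ⟩
    y * y + y * y            ≡⟨ x+x≡0 _ ⟩
    0#                       ∎))

  private
    prod : List Carrier → Carrier
    prod = foldr _*_ 1#

    nonzero : List Carrier
    nonzero = filter (λ x → ¬? (x ≟ 0#)) elements

    ∈-nonzero⁻ : ∀ {z} → z ∈ nonzero → z ≢ 0#
    ∈-nonzero⁻ z∈ = proj₂ (∈-filter⁻ (λ x → ¬? (x ≟ 0#)) {xs = elements} z∈)

    suc-length-nonzero : suc (length nonzero) ≡ 2 ℕ.^ n
    suc-length-nonzero = trans
      (cong (ℕ._+ length nonzero) (sym (length-filter-≟-complete _≟_ unique complete 0#)))
      (trans (length-filter-+-∁ (_≟ 0#) elements) card)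

    prod≢0 : ∀ xs → (∀ {z} → z ∈ xs → z ≢ 0#) → prod xs ≢ 0#
    prod≢0 [] _ = 1≢0
    prod≢0 (x ∷ xs) xs≢0 = x≢0∧y≢0⇒x*y≢0 (xs≢0 (here refl)) (prod≢0 xs (xs≢0 ∘ there))

    prod-map-* : ∀ a xs → prod (map (a *_) xs) ≡ pow 𝔽 a (length xs) * prod xs
    prod-map-* a [] = sym (*-identityˡ 1#)
    prod-map-* a (x ∷ xs) = trans (cong ((a * x) *_) (prod-map-* a xs)) (*-interchange a x _ _)

    map-*-nonzero-↭ : ∀ a → a ≢ 0# → map (a *_) nonzero ↭ nonzero
    map-*-nonzero-↭ a a≢0 = unique-sameMembers⇒↭ (map⁺ (*-cancelˡ a a≢0) nonzero!) nonzero! ⊆ ⊇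
      where
      nonzero! = filter⁺ (λ x → ¬? (x ≟ 0#)) unique
      ⊆ : ∀ {z} → z ∈ map (a *_) nonzero → z ∈ nonzero
      ⊆ {z} z∈ with ∈-map⁻ (a *_) z∈
      ... | x , x∈ , refl = ∈-filter⁺ (λ x → ¬? (x ≟ 0#)) (complete z) (x≢0∧y≢0⇒x*y≢0 a≢0 (∈-nonzero⁻ x∈))
      ⊇ : ∀ {z} → z ∈ nonzero → z ∈ map (a *_) nonzero
      ⊇ {z} z∈ with inverse a a≢0
      ... | a⁻¹ , aa⁻¹≡1 = subst (_∈ map (a *_) nonzero) a[a⁻¹z]≡z
        (∈-map⁺ (a *_) (∈-filter⁺ (λ x → ¬? (x ≟ 0#)) (complete (a⁻¹ * z)) (x≢0∧y≢0⇒x*y≢0 a⁻¹≢0 (∈-nonzero⁻ z∈))))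
        where
        a⁻¹≢0 : a⁻¹ ≢ 0#
        a⁻¹≢0 a⁻¹≡0 = 1≢0 (trans (sym aa⁻¹≡1) (trans (cong (a *_) a⁻¹≡0) (zeroʳ a)))
        a[a⁻¹z]≡z : a * (a⁻¹ * z) ≡ z
        a[a⁻¹z]≡z = trans (sym (*-assoc a a⁻¹ z)) (trans (cong (_* z) aa⁻¹≡1) (*-identityˡ z))

    pow-length-nonzero : ∀ a → a ≢ 0# → pow 𝔽 a (length nonzero) ≡ 1#
    pow-length-nonzero a a≢0 = *-cancelˡ (prod nonzero) (prod≢0 nonzero ∈-nonzero⁻) (begin
      prod nonzero * pow 𝔽 a (length nonzero) ≡⟨ *-comm _ _ ⟩
      pow 𝔽 a (length nonzero) * prod nonzero ≡⟨ sym (prod-map-* a nonzero) ⟩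
      prod (map (a *_) nonzero)               ≡⟨ Perm.foldr-commMonoid (setoid Carrier) *-isCommutativeMonoid (↭⇒↭ₛ (map-*-nonzero-↭ a a≢0)) ⟩
      prod nonzero                            ≡⟨ sym (*-identityʳ _) ⟩
      prod nonzero * 1#                       ∎)

  pow-2^n : ∀ x → pow 𝔽 x (2 ℕ.^ n) ≡ x
  pow-2^n x = subst (λ m → pow 𝔽 x m ≡ x) suc-length-nonzero (x·xᴺ≡x (x ≟ 0#))
    where
    x·xᴺ≡x : Dec (x ≡ 0#) → x * pow 𝔽 x (length nonzero) ≡ x
    x·xᴺ≡x (yes x≡0) = trans (cong (_* pow 𝔽 x (length nonzero)) x≡0) (trans (zeroˡ _) (sym x≡0))
    x·xᴺ≡x (no x≢0) = trans (cong (x *_) (pow-length-nonzero x x≢0)) (*-identityʳ x)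

  frob : ℕ → Carrier → Carrier
  frob j x = pow 𝔽 x (2 ℕ.^ j)

  frob-zero : ∀ x → frob 0 x ≡ x
  frob-zero = *-identityʳ

  frob-suc : ∀ j x → frob (suc j) x ≡ frob j (x * x)
  frob-suc j x = trans (pow-* x 2 (2 ℕ.^ j)) (cong (λ w → pow 𝔽 (x * w) (2 ℕ.^ j)) (*-identityʳ x))

  frob-homo-+ : ∀ j x y → frob j (x + y) ≡ frob j x + frob j y
  frob-homo-+ zero x y = trans (frob-zero _) (sym (cong₂ _+_ (frob-zero x) (frob-zero y)))
  frob-homo-+ (suc j) x y = begin
    frob (suc j) (x + y)         ≡⟨ frob-suc j (x + y) ⟩
    frob j ((x + y) * (x + y))   ≡⟨ cong (frob j) (square-+ x y) ⟩
    frob j (x * x + y * y)       ≡⟨ frob-homo-+ j (x * x) (y * y) ⟩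
    frob j (x * x) + frob j (y * y) ≡⟨ sym (cong₂ _+_ (frob-suc j x) (frob-suc j y)) ⟩
    frob (suc j) x + frob (suc j) y ∎

  frob-homo-* : ∀ j x y → frob j (x * y) ≡ frob j x * frob j y
  frob-homo-* j x y = pow-distrib-* x y (2 ℕ.^ j)

  frob-1# : ∀ j → frob j 1# ≡ 1#
  frob-1# j = pow-1# (2 ℕ.^ j)

  frob-0# : ∀ j → frob j 0# ≡ 0#
  frob-0# zero = frob-zero 0#
  frob-0# (suc j) = trans (frob-suc j 0#) (trans (cong (frob j) (zeroˡ 0#)) (frob-0# j))

  frob-compose : ∀ i j x → frob (i ℕ.+ j) x ≡ frob i (frob j x)
  frob-compose i j x = begin
    pow 𝔽 x (2 ℕ.^ (i ℕ.+ j))        ≡⟨ cong (pow 𝔽 x) (trans (ℕ.^-distribˡ-+-* 2 i j) (ℕ.*-comm (2 ℕ.^ i) (2 ℕ.^ j))) ⟩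
    pow 𝔽 x (2 ℕ.^ j ℕ.* 2 ℕ.^ i)    ≡⟨ pow-* x (2 ℕ.^ j) (2 ℕ.^ i) ⟩
    frob i (frob j x)                ∎

  frob-comm : ∀ i j x → frob i (frob j x) ≡ frob j (frob i x)
  frob-comm i j x = trans (sym (frob-compose i j x)) (trans (cong (λ m → frob m x) (ℕ.+-comm i j)) (frob-compose j i x))

  frob-*n : ∀ l x → frob (l ℕ.* n) x ≡ x
  frob-*n zero x = frob-zero x
  frob-*n (suc l) x = trans (frob-compose n (l ℕ.* n) x) (trans (pow-2^n _) (frob-*n l x))

  frob-bézout : ∀ {e k} .{{_ : ℕ.NonZero n}} → Identity e k n → Σ ℕ λ r → ∀ w → frob (r ℕ.* k) w ≡ frob e w
  frob-bézout {e} {k} (+- x y e+yn≡xk) = x , λ w → begin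
    frob (x ℕ.* k) w          ≡⟨ cong (λ m → frob m w) (sym e+yn≡xk) ⟩
    frob (e ℕ.+ y ℕ.* n) w    ≡⟨ frob-compose e (y ℕ.* n) w ⟩
    frob e (frob (y ℕ.* n) w) ≡⟨ cong (frob e) (frob-*n y w) ⟩
    frob e w                  ∎
  frob-bézout {e} {k} (-+ x y e+xk≡yn) = r , λ w → sym (begin
    frob e w                                         ≡⟨ cong (frob e) (sym (frob-*n (x ℕ.* k) w)) ⟩
    frob e (frob (x ℕ.* k ℕ.* n) w)                  ≡⟨ cong (λ m → frob e (frob m w)) xk·n≡xk+rk ⟩
    frob e (frob (x ℕ.* k ℕ.+ r ℕ.* k) w)            ≡⟨ cong (frob e) (frob-compose (x ℕ.* k) (r ℕ.* k) w) ⟩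
    frob e (frob (x ℕ.* k) (frob (r ℕ.* k) w))       ≡⟨ sym (frob-compose e (x ℕ.* k) _) ⟩
    frob (e ℕ.+ x ℕ.* k) (frob (r ℕ.* k) w)          ≡⟨ cong (λ m → frob m (frob (r ℕ.* k) w)) e+xk≡yn ⟩
    frob (y ℕ.* n) (frob (r ℕ.* k) w)                ≡⟨ frob-*n y _ ⟩
    frob (r ℕ.* k) w                                 ∎)
    where
    -- r · k ≡ (n − 1) · x · k ≡ − x · k ≡ e modulo n
    r = x ℕ.* ℕ.pred n
    xk·n≡xk+rk : x ℕ.* k ℕ.* n ≡ x ℕ.* k ℕ.+ r ℕ.* k
    xk·n≡xk+rk = begin
      x ℕ.* k ℕ.* n                    ≡⟨ cong (x ℕ.* k ℕ.*_) (sym (ℕ.suc-pred n)) ⟩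
      x ℕ.* k ℕ.* suc (ℕ.pred n)       ≡⟨ ℕ.*-suc (x ℕ.* k) (ℕ.pred n) ⟩
      x ℕ.* k ℕ.+ x ℕ.* k ℕ.* ℕ.pred n ≡⟨ cong (x ℕ.* k ℕ.+_) (trans (ℕ.*-assoc x k _) (trans (cong (x ℕ.*_) (ℕ.*-comm k _)) (sym (ℕ.*-assoc x _ k)))) ⟩
      x ℕ.* k ℕ.+ r ℕ.* k              ∎

  frob-fixed-* : ∀ j {u} → frob j u ≡ u → ∀ i → frob (i ℕ.* j) u ≡ u
  frob-fixed-* j fixed zero = frob-zero _
  frob-fixed-* j {u} fixed (suc i) = trans (frob-compose j (i ℕ.* j) u) (trans (cong (frob j) (frob-fixed-* j fixed i)) fixed)

  frob-injective : ∀ j {x y} → frob j x ≡ frob j y → x ≡ y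
  frob-injective zero φx≡φy = trans (sym (frob-zero _)) (trans φx≡φy (frob-zero _))
  frob-injective (suc j) {x} {y} φx≡φy =
    square-injective (frob-injective j (trans (sym (frob-suc j x)) (trans φx≡φy (frob-suc j y))))

  Σ< : ℕ → (ℕ → Carrier) → Carrier
  Σ< zero f = 0#
  Σ< (suc j) f = f 0 + Σ< j (f ∘ suc)

  Σ<-cong : ∀ j {f g} → (∀ i → f i ≡ g i) → Σ< j f ≡ Σ< j g
  Σ<-cong zero f≗g = refl
  Σ<-cong (suc j) f≗g = cong₂ _+_ (f≗g 0) (Σ<-cong j (f≗g ∘ suc))

  Σ<-+ : ∀ j f g → Σ< j (λ i → f i + g i) ≡ Σ< j f + Σ< j g
  Σ<-+ zero f g = sym (+-identityʳ 0#)
  Σ<-+ (suc j) f g = trans (cong (f 0 + g 0 +_) (Σ<-+ j (f ∘ suc) (g ∘ suc))) (+-interchange _ _ _ _)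

  Σ<-*ˡ : ∀ c j f → Σ< j (λ i → c * f i) ≡ c * Σ< j f
  Σ<-*ˡ c zero f = sym (zeroʳ c)
  Σ<-*ˡ c (suc j) f = trans (cong (c * f 0 +_) (Σ<-*ˡ c j (f ∘ suc))) (sym (distribˡ c _ _))

  Σ<-square : ∀ j f → Σ< j (λ i → f i * f i) ≡ Σ< j f * Σ< j f
  Σ<-square zero f = sym (zeroˡ 0#)
  Σ<-square (suc j) f = trans (cong (f 0 * f 0 +_) (Σ<-square j (f ∘ suc))) (sym (square-+ _ _))

  Σ<-frob : ∀ m j f → frob m (Σ< j f) ≡ Σ< j (frob m ∘ f)
  Σ<-frob m zero f = frob-0# m
  Σ<-frob m (suc j) f = trans (frob-homo-+ m _ _) (cong (frob m (f 0) +_) (Σ<-frob m j (f ∘ suc)))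

  Σ<-telescope : ∀ j (f : ℕ → Carrier) → Σ< j (λ i → f (suc i) + f i) ≡ f j + f 0
  Σ<-telescope zero f = sym (x+x≡0 _)
  Σ<-telescope (suc j) f = trans (cong (f 1 + f 0 +_) (Σ<-telescope j (f ∘ suc)))
    (solve 3 (λ a b c → (a :+ b) :+ (c :+ a) := c :+ b) refl (f 1) (f 0) (f (suc j)))

  Σ<-suc : ∀ j f → Σ< (suc j) f ≡ Σ< j f + f j
  Σ<-suc zero f = trans (+-identityʳ _) (sym (+-identityˡ _))
  Σ<-suc (suc j) f = trans (cong (f 0 +_) (Σ<-suc j (f ∘ suc))) (sym (+-assoc _ _ _))

  Σ<-2* : ∀ j f → Σ< (2 ℕ.* j) f ≡ Σ< j (λ i → f (2 ℕ.* i) + f (suc (2 ℕ.* i)))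
  Σ<-2* zero f = refl
  Σ<-2* (suc j) f = begin
    Σ< (2 ℕ.* suc j) f                                      ≡⟨ cong (λ m → Σ< m f) (2*suc j) ⟩
    f 0 + (f 1 + Σ< (2 ℕ.* j) (f ∘ suc ∘ suc))               ≡⟨ sym (+-assoc (f 0) (f 1) _) ⟩
    (f 0 + f 1) + Σ< (2 ℕ.* j) (f ∘ suc ∘ suc)               ≡⟨ cong ((f 0 + f 1) +_) (trans (Σ<-2* j (f ∘ suc ∘ suc))
                                                                  (Σ<-cong j (λ i → cong (λ m → f m + f (suc m)) (sym (2*suc i))))) ⟩
    Σ< (suc j) (λ i → f (2 ℕ.* i) + f (suc (2 ℕ.* i)))      ∎
    where
    2*suc : ∀ i → 2 ℕ.* suc i ≡ suc (suc (2 ℕ.* i))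
    2*suc i = cong suc (ℕ.+-suc i (i ℕ.+ 0))

  Σ<-const-odd : ∀ h c → Σ< (suc (2 ℕ.* h)) (λ _ → c) ≡ c
  Σ<-const-odd h c = begin
    c + Σ< (2 ℕ.* h) (λ _ → c)  ≡⟨ cong (c +_) (trans (Σ<-2* h (λ _ → c)) (Σ<-cong h (λ _ → x+x≡0 c))) ⟩
    c + Σ< h (λ _ → 0#)         ≡⟨ cong (c +_) (Σ<-zero h) ⟩
    c + 0#                      ≡⟨ +-identityʳ c ⟩
    c                           ∎
    where
    Σ<-zero : ∀ j → Σ< j (λ _ → 0#) ≡ 0#
    Σ<-zero zero = refl
    Σ<-zero (suc j) = trans (+-identityˡ _) (Σ<-zero j)

  -- monic cs is the monic polynomial x ^ length cs + Σᵢ csᵢ xⁱ.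
  monic : List Carrier → Carrier → Carrier
  monic [] x = 1#
  monic (c ∷ cs) x = c + x * monic cs x

  monic-divide : ∀ c cs r → Σ (List Carrier) λ qs → length qs ≡ length cs ×
                 (∀ x → monic (c ∷ cs) x ≡ monic (c ∷ cs) r + (x + r) * monic qs x)
  monic-divide c [] r = [] , refl , λ x → solve 3 (λ c x r → c :+ x :* con true := (c :+ r :* con true) :+ (x :+ r) :* con true) refl c x r
  monic-divide c (c′ ∷ cs) r with monic-divide c′ cs r
  ... | qs , |qs|≡|cs| , divides = monic (c′ ∷ cs) r ∷ qs , cong suc |qs|≡|cs| , λ x → begin
    c + x * monic (c′ ∷ cs) x                                ≡⟨ cong (λ w → c + x * w) (divides x) ⟩
    c + x * (monic (c′ ∷ cs) r + (x + r) * monic qs x)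
      ≡⟨ solve 5 (λ c x r p q → c :+ x :* (p :+ (x :+ r) :* q) := (c :+ r :* p) :+ (x :+ r) :* (p :+ x :* q))
               refl c x r (monic (c′ ∷ cs) r) (monic qs x) ⟩
    (c + r * monic (c′ ∷ cs) r) + (x + r) * (monic (c′ ∷ cs) r + x * monic qs x) ∎

  monic-roots≤degree : ∀ cs rs → Unique rs → (∀ {z} → z ∈ rs → monic cs z ≡ 0#) → length rs ≤ length cs
  monic-roots≤degree cs [] _ _ = z≤n
  monic-roots≤degree [] (r ∷ rs) _ roots = ⊥-elim (1≢0 (roots (here refl)))
  monic-roots≤degree (c ∷ cs) (r ∷ rs) (r∉rs ∷ rs!) roots with monic-divide c cs r
  ... | qs , |qs|≡|cs| , divides = s≤s (subst (length rs ≤_) |qs|≡|cs| (monic-roots≤degree qs rs rs! quotient-roots))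
    where
    quotient-roots : ∀ {z} → z ∈ rs → monic qs z ≡ 0#
    quotient-roots {z} z∈rs with x*y≡0⇒x≡0⊎y≡0 (begin
      (z + r) * monic qs z                          ≡⟨ sym (+-identityˡ _) ⟩
      0# + (z + r) * monic qs z                     ≡⟨ cong (_+ (z + r) * monic qs z) (sym (roots (here refl))) ⟩
      monic (c ∷ cs) r + (z + r) * monic qs z       ≡⟨ sym (divides z) ⟩
      monic (c ∷ cs) z                              ≡⟨ roots (there z∈rs) ⟩
      0#                                            ∎)
    ... | inj₁ z+r≡0 = ⊥-elim (All.lookup r∉rs z∈rs (sym (x+y≡0⇒x≡y z+r≡0)))
    ... | inj₂ q[z]≡0 = q[z]≡0

  addTerm : Carrier → ℕ → List Carrier → List Carrier
  addTerm a i [] = []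
  addTerm a zero (c ∷ cs) = (a + c) ∷ cs
  addTerm a (suc i) (c ∷ cs) = c ∷ addTerm a i cs

  length-addTerm : ∀ a i cs → length (addTerm a i cs) ≡ length cs
  length-addTerm a i [] = refl
  length-addTerm a zero (c ∷ cs) = refl
  length-addTerm a (suc i) (c ∷ cs) = cong suc (length-addTerm a i cs)

  monic-addTerm : ∀ a i cs → i < length cs → ∀ x → monic (addTerm a i cs) x ≡ a * pow 𝔽 x i + monic cs x
  monic-addTerm a zero (c ∷ cs) _ x = solve 4 (λ a c x p → (a :+ c) :+ x :* p := a :* con true :+ (c :+ x :* p)) refl a c x (monic cs x)
  monic-addTerm a (suc i) (c ∷ cs) (s≤s i<|cs|) x = begin
    c + x * monic (addTerm a i cs) x        ≡⟨ cong (λ w → c + x * w) (monic-addTerm a i cs i<|cs| x) ⟩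
    c + x * (a * pow 𝔽 x i + monic cs x)     ≡⟨ solve 5 (λ a c x p q → c :+ x :* (a :* p :+ q) := a :* (x :* p) :+ (c :+ x :* q))
                                                   refl a c x (pow 𝔽 x i) (monic cs x) ⟩
    a * (x * pow 𝔽 x i) + (c + x * monic cs x) ∎

  addTerms : ℕ → (ℕ → ℕ) → List Carrier → List Carrier
  addTerms zero h cs = cs
  addTerms (suc j) h cs = addTerm 1# (h 0) (addTerms j (h ∘ suc) cs)

  length-addTerms : ∀ j h cs → length (addTerms j h cs) ≡ length cs
  length-addTerms zero h cs = refl
  length-addTerms (suc j) h cs = trans (length-addTerm 1# (h 0) (addTerms j (h ∘ suc) cs)) (length-addTerms j (h ∘ suc) cs)

  monic-addTerms : ∀ j h cs → (∀ i → i < j → h i < length cs) → ∀ x →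
                   monic (addTerms j h cs) x ≡ Σ< j (λ i → pow 𝔽 x (h i)) + monic cs x
  monic-addTerms zero h cs h<|cs| x = sym (+-identityˡ _)
  monic-addTerms (suc j) h cs h<|cs| x = begin
    monic (addTerm 1# (h 0) (addTerms j (h ∘ suc) cs)) x
      ≡⟨ monic-addTerm 1# (h 0) (addTerms j (h ∘ suc) cs) (subst (h 0 <_) (sym (length-addTerms j (h ∘ suc) cs)) (h<|cs| 0 (s≤s z≤n))) x ⟩
    1# * pow 𝔽 x (h 0) + monic (addTerms j (h ∘ suc) cs) x
      ≡⟨ cong₂ _+_ (*-identityˡ _) (monic-addTerms j (h ∘ suc) cs (λ i → h<|cs| (suc i) ∘ s≤s) x) ⟩
    pow 𝔽 x (h 0) + (Σ< j (λ i → pow 𝔽 x (h (suc i))) + monic cs x)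
      ≡⟨ sym (+-assoc _ _ _) ⟩
    Σ< (suc j) (λ i → pow 𝔽 x (h i)) + monic cs x ∎

  monic-replicate-0# : ∀ N x → monic (replicate N 0#) x ≡ pow 𝔽 x N
  monic-replicate-0# zero x = refl
  monic-replicate-0# (suc N) x = trans (+-identityˡ _) (cong (x *_) (monic-replicate-0# N x))

module RelativeTrace {n : ℕ} (𝔽 : FiniteField n) (e h : ℕ) (d*e≡n : suc (2 ℕ.* h) ℕ.* e ≡ n) where
  open FieldFacts 𝔽
  open ≡-Reasoning

  d : ℕ
  d = suc (2 ℕ.* h)

  Tr : Carrier → Carrier
  Tr = relTrace 𝔽 e d

  conjugate : Carrier → ℕ → Carrier
  conjugate z i = frob (i ℕ.* e) z

  Tr≡Σ<-conjugate : ∀ z → Tr z ≡ Σ< d (conjugate z)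
  Tr≡Σ<-conjugate z = trans (cong (foldr _+_ 0#) (map-applyUpTo (λ i → i) (conjugate z) d)) (foldr-applyUpTo (conjugate z) d)
    where
    foldr-applyUpTo : ∀ f j → foldr _+_ 0# (applyUpTo f j) ≡ Σ< j f
    foldr-applyUpTo f zero = refl
    foldr-applyUpTo f (suc j) = cong (f 0 +_) (foldr-applyUpTo (f ∘ suc) j)

  conjugate-suc : ∀ z i → conjugate (frob e z) i ≡ conjugate z (suc i)
  conjugate-suc z i = trans (sym (frob-compose (i ℕ.* e) e z)) (cong (λ m → frob m z) (ℕ.+-comm (i ℕ.* e) e))

  conjugate-d : ∀ z → conjugate z d ≡ z
  conjugate-d z = trans (cong (λ m → frob m z) d*e≡n) (pow-2^n z)

  Tr-homo-+ : ∀ z w → Tr (z + w) ≡ Tr z + Tr w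
  Tr-homo-+ z w = begin
    Tr (z + w)                                 ≡⟨ Tr≡Σ<-conjugate (z + w) ⟩
    Σ< d (conjugate (z + w))                   ≡⟨ Σ<-cong d (λ i → frob-homo-+ (i ℕ.* e) z w) ⟩
    Σ< d (λ i → conjugate z i + conjugate w i) ≡⟨ Σ<-+ d (conjugate z) (conjugate w) ⟩
    Σ< d (conjugate z) + Σ< d (conjugate w)    ≡⟨ sym (cong₂ _+_ (Tr≡Σ<-conjugate z) (Tr≡Σ<-conjugate w)) ⟩
    Tr z + Tr w                                ∎

  Tr-square : ∀ z → Tr (z * z) ≡ Tr z * Tr z
  Tr-square z = begin
    Tr (z * z)                                 ≡⟨ Tr≡Σ<-conjugate (z * z) ⟩
    Σ< d (conjugate (z * z))                   ≡⟨ Σ<-cong d (λ i → frob-homo-* (i ℕ.* e) z z) ⟩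
    Σ< d (λ i → conjugate z i * conjugate z i) ≡⟨ Σ<-square d (conjugate z) ⟩
    Σ< d (conjugate z) * Σ< d (conjugate z)    ≡⟨ sym (cong₂ _*_ (Tr≡Σ<-conjugate z) (Tr≡Σ<-conjugate z)) ⟩
    Tr z * Tr z                                ∎

  Tr-*ˡ : ∀ {u} → frob e u ≡ u → ∀ z → Tr (u * z) ≡ u * Tr z
  Tr-*ˡ {u} u-fixed z = begin
    Tr (u * z)                        ≡⟨ Tr≡Σ<-conjugate (u * z) ⟩
    Σ< d (conjugate (u * z))          ≡⟨ Σ<-cong d (λ i → trans (frob-homo-* (i ℕ.* e) u z) (cong (_* conjugate z i) (frob-fixed-* e u-fixed i))) ⟩
    Σ< d (λ i → u * conjugate z i)    ≡⟨ Σ<-*ˡ u d (conjugate z) ⟩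
    u * Σ< d (conjugate z)            ≡⟨ cong (u *_) (sym (Tr≡Σ<-conjugate z)) ⟩
    u * Tr z                          ∎

  -- The odd degree d = n / e is what makes Tr the identity on 𝔽_{2^e}.
  Tr-fixed : ∀ {u} → frob e u ≡ u → Tr u ≡ u
  Tr-fixed {u} u-fixed = trans (Tr≡Σ<-conjugate u) (trans (Σ<-cong d (frob-fixed-* e u-fixed)) (Σ<-const-odd h u))

  Tr-frob : ∀ z → Tr (frob e z) ≡ Tr z
  Tr-frob z = x+y≡0⇒x≡y (begin
    Tr (frob e z) + Tr z                                     ≡⟨ sym (Tr-homo-+ (frob e z) z) ⟩
    Tr (frob e z + z)                                        ≡⟨ Tr≡Σ<-conjugate _ ⟩
    Σ< d (conjugate (frob e z + z))                          ≡⟨ Σ<-cong d (λ i → trans (frob-homo-+ (i ℕ.* e) (frob e z) z) (cong (_+ conjugate z i) (conjugate-suc z i))) ⟩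
    Σ< d (λ i → conjugate z (suc i) + conjugate z i)         ≡⟨ Σ<-telescope d (conjugate z) ⟩
    conjugate z d + conjugate z 0                            ≡⟨ cong₂ _+_ (conjugate-d z) (frob-zero z) ⟩
    z + z                                                    ≡⟨ x+x≡0 z ⟩
    0#                                                       ∎)

  Tr-frob-* : ∀ m z → Tr (frob (m ℕ.* e) z) ≡ Tr z
  Tr-frob-* zero z = cong Tr (frob-zero z)
  Tr-frob-* (suc m) z = trans (cong Tr (frob-compose e (m ℕ.* e) z)) (trans (Tr-frob _) (Tr-frob-* m z))

  frob-Tr : ∀ z → frob e (Tr z) ≡ Tr z
  frob-Tr z = begin
    frob e (Tr z)                        ≡⟨ cong (frob e) (Tr≡Σ<-conjugate z) ⟩
    frob e (Σ< d (conjugate z))          ≡⟨ Σ<-frob e d (conjugate z) ⟩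
    Σ< d (frob e ∘ conjugate z)          ≡⟨ Σ<-cong d (λ i → frob-comm e (i ℕ.* e) z) ⟩
    Σ< d (conjugate (frob e z))          ≡⟨ sym (Tr≡Σ<-conjugate _) ⟩
    Tr (frob e z)                        ≡⟨ Tr-frob z ⟩
    Tr z                                 ∎

  -- With d = 2h + 1, the even conjugates of c give H with H + H^{2^e} = Tr c + c.
  frob-+-id-surjective : ∀ c → Tr c ≡ 0# → ∃ λ H → frob e H + H ≡ c
  frob-+-id-surjective c Tr[c]≡0 = H , (begin
    frob e H + H                                                   ≡⟨ +-comm (frob e H) H ⟩
    H + frob e H                                                   ≡⟨ cong (H +_) (Σ<-frob e (suc h) (conjugate c ∘ (2 ℕ.*_))) ⟩
    H + Σ< (suc h) (frob e ∘ conjugate c ∘ (2 ℕ.*_))               ≡⟨ sym (Σ<-+ (suc h) (conjugate c ∘ (2 ℕ.*_)) (frob e ∘ conjugate c ∘ (2 ℕ.*_))) ⟩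
    Σ< (suc h) (λ i → conjugate c (2 ℕ.* i) + frob e (conjugate c (2 ℕ.* i)))
      ≡⟨ Σ<-cong (suc h) (λ i → cong (conjugate c (2 ℕ.* i) +_) (trans (frob-comm e (2 ℕ.* i ℕ.* e) c) (conjugate-suc c (2 ℕ.* i)))) ⟩
    Σ< (suc h) (λ i → conjugate c (2 ℕ.* i) + conjugate c (suc (2 ℕ.* i))) ≡⟨ sym (Σ<-2* (suc h) (conjugate c)) ⟩
    Σ< (2 ℕ.* suc h) (conjugate c)                                 ≡⟨ cong (λ m → Σ< m (conjugate c)) (cong suc (ℕ.+-suc h (h ℕ.+ 0))) ⟩
    Σ< (suc d) (conjugate c)                                       ≡⟨ Σ<-suc d (conjugate c) ⟩
    Σ< d (conjugate c) + conjugate c d                             ≡⟨ cong₂ _+_ (trans (sym (Tr≡Σ<-conjugate c)) Tr[c]≡0) (conjugate-d c) ⟩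
    0# + c                                                         ≡⟨ +-identityˡ c ⟩
    c                                                              ∎)
    where
    H = Σ< (suc h) (conjugate c ∘ (2 ℕ.*_))

  fixedField : List Carrier
  fixedField = filter (λ x → frob e x ≟ x) elements

  module _ .{{e≢0 : ℕ.NonZero e}} where

    -- The roots of x^{2^e} + x.
    length-fixedField≤ : length fixedField ≤ 2 ℕ.^ e
    length-fixedField≤ = subst (length fixedField ≤_) |cs|≡2^e
      (monic-roots≤degree cs fixedField (filter⁺ (λ x → frob e x ≟ x) unique) roots)
      where
      cs = addTerm 1# 1 (replicate (2 ℕ.^ e) 0#)
      |cs|≡2^e : length cs ≡ 2 ℕ.^ e
      |cs|≡2^e = trans (length-addTerm 1# 1 (replicate (2 ℕ.^ e) 0#)) (length-replicate (2 ℕ.^ e))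
      1<2^e : 1 < length (replicate (2 ℕ.^ e) 0#)
      1<2^e = subst (1 <_) (sym (length-replicate (2 ℕ.^ e))) (ℕ.^-monoʳ-< 2 (s≤s (s≤s z≤n)) (ℕ.>-nonZero⁻¹ e))
      roots : ∀ {z} → z ∈ fixedField → monic cs z ≡ 0#
      roots {z} z∈ = begin
        monic cs z                     ≡⟨ monic-addTerm 1# 1 (replicate (2 ℕ.^ e) 0#) 1<2^e z ⟩
        1# * (z * 1#) + monic (replicate (2 ℕ.^ e) 0#) z ≡⟨ cong₂ _+_ (trans (*-identityˡ _) (*-identityʳ z)) (monic-replicate-0# (2 ℕ.^ e) z) ⟩
        z + frob e z                   ≡⟨ cong (z +_) (proj₂ (∈-filter⁻ (λ x → frob e x ≟ x) {xs = elements} z∈)) ⟩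
        z + z                          ≡⟨ x+x≡0 z ⟩
        0#                             ∎

    -- Tr z + s₀ is monic of degree 2^{(d-1)e} in z.
    Tr-fibreSize≤ : ∀ s₀ → fibreSize _≟_ Tr elements s₀ ≤ 2 ℕ.^ (2 ℕ.* h ℕ.* e)
    Tr-fibreSize≤ s₀ = subst (fibreSize _≟_ Tr elements s₀ ≤_) |cs|≡N
      (monic-roots≤degree cs (filter (λ z → Tr z ≟ s₀) elements) (filter⁺ (λ z → Tr z ≟ s₀) unique) roots)
      where
      N = 2 ℕ.^ (2 ℕ.* h ℕ.* e)
      terms = addTerms (2 ℕ.* h) (λ i → 2 ℕ.^ (i ℕ.* e)) (replicate N 0#)
      cs = addTerm s₀ 0 terms
      |terms|≡N : length terms ≡ N
      |terms|≡N = trans (length-addTerms (2 ℕ.* h) _ (replicate N 0#)) (length-replicate N)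
      |cs|≡N : length cs ≡ N
      |cs|≡N = trans (length-addTerm s₀ 0 terms) |terms|≡N
      exponents< : ∀ i → i < 2 ℕ.* h → 2 ℕ.^ (i ℕ.* e) < length (replicate N 0#)
      exponents< i i<2h = subst (2 ℕ.^ (i ℕ.* e) <_) (sym (length-replicate N))
        (ℕ.^-monoʳ-< 2 (s≤s (s≤s z≤n)) (ℕ.*-monoˡ-< e i<2h))
      roots : ∀ {z} → z ∈ filter (λ z → Tr z ≟ s₀) elements → monic cs z ≡ 0#
      roots {z} z∈ = begin
        monic cs z                                          ≡⟨ monic-addTerm s₀ 0 terms (subst (0 <_) (sym |terms|≡N) (ℕ.m^n>0 2 (2 ℕ.* h ℕ.* e))) z ⟩
        s₀ * 1# + monic terms z                             ≡⟨ cong₂ _+_ (*-identityʳ s₀) (monic-addTerms (2 ℕ.* h) _ (replicate N 0#) exponents< z) ⟩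
        s₀ + (Σ< (2 ℕ.* h) (conjugate z) + monic (replicate N 0#) z)
                                                            ≡⟨ cong (λ w → s₀ + (Σ< (2 ℕ.* h) (conjugate z) + w)) (monic-replicate-0# N z) ⟩
        s₀ + (Σ< (2 ℕ.* h) (conjugate z) + conjugate z (2 ℕ.* h))
                                                            ≡⟨ cong (s₀ +_) (sym (trans (Tr≡Σ<-conjugate z) (Σ<-suc (2 ℕ.* h) (conjugate z)))) ⟩
        s₀ + Tr z                                           ≡⟨ cong (s₀ +_) (proj₂ (∈-filter⁻ (λ z → Tr z ≟ s₀) {xs = elements} z∈)) ⟩
        s₀ + s₀                                             ≡⟨ x+x≡0 s₀ ⟩
        0#                                                  ∎

    -- Tr maps 𝔽 into the fixed field, with fibres of size at most 2^{n-e}.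
    2^e≤length-fixedField : 2 ℕ.^ e ≤ length fixedField
    2^e≤length-fixedField = ℕ.*-cancelʳ-≤ (2 ℕ.^ e) (length fixedField) (2 ℕ.^ (2 ℕ.* h ℕ.* e)) {{ℕ.m^n≢0 2 (2 ℕ.* h ℕ.* e)}}
      (ℕ.≤-trans (ℕ.≤-reflexive (trans (sym (ℕ.^-distribˡ-+-* 2 e (2 ℕ.* h ℕ.* e))) (trans (cong (2 ℕ.^_) d*e≡n) (sym card))))
        (length-≤-image×fibreSize _≟_ Tr elements fixedField
          (λ x → ∈-filter⁺ (λ x → frob e x ≟ x) (complete (Tr x)) (frob-Tr x)) Tr-fibreSize≤))

    length-fixedField : length fixedField ≡ 2 ℕ.^ e
    length-fixedField = ℕ.≤-antisym length-fixedField≤ 2^e≤length-fixedField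

module GoldBoomerang {n : ℕ} (𝔽 : FiniteField n) .{{n≢0 : ℕ.NonZero n}} (k e h : ℕ)
                     (d*e≡n : suc (2 ℕ.* h) ℕ.* e ≡ n) (e∣k : e ∣ k) (bézout : Identity e k n) where
  open FieldFacts 𝔽
  open RelativeTrace 𝔽 e h d*e≡n
  open ≡-Reasoning
  open _∣_ e∣k using (quotient; equality)

  private
    r : ℕ
    r = proj₁ (frob-bézout bézout)

    frob-r*k : ∀ w → frob (r ℕ.* k) w ≡ frob e w
    frob-r*k = proj₂ (frob-bézout bézout)

  fixed-k⇒fixed-e : ∀ {u} → frob k u ≡ u → frob e u ≡ u
  fixed-k⇒fixed-e {u} fixed = trans (sym (frob-r*k u)) (frob-fixed-* k fixed r)

  fixed-e⇒fixed-k : ∀ {u} → frob e u ≡ u → frob k u ≡ u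
  fixed-e⇒fixed-k {u} fixed = trans (cong (λ j → frob j u) equality) (frob-fixed-* e fixed quotient)

  Tr-frob-k : ∀ z → Tr (frob k z) ≡ Tr z
  Tr-frob-k z = trans (cong (λ j → Tr (frob j z)) equality) (Tr-frob-* quotient z)

  L : Carrier → Carrier
  L x = frob k x + x

  L-homo-+ : ∀ x y → L (x + y) ≡ L x + L y
  L-homo-+ x y = trans (cong (_+ (x + y)) (frob-homo-+ k x y))
    (solve 4 (λ a b x y → (a :+ b) :+ (x :+ y) := (a :+ x) :+ (b :+ y)) refl (frob k x) (frob k y) x y)

  Tr-L : ∀ x → Tr (L x) ≡ 0#
  Tr-L x = trans (Tr-homo-+ (frob k x) x) (trans (cong (_+ Tr x) (Tr-frob-k x)) (x+x≡0 (Tr x)))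

  L-preimage : ∀ c → Tr c ≡ 0# → ∃ λ x₀ → L x₀ ≡ c
  L-preimage c Tr[c]≡0 with frob-+-id-surjective c Tr[c]≡0
  ... | H , frob[H]+H≡c = Σ< r orbit , (begin
    frob k (Σ< r orbit) + Σ< r orbit                   ≡⟨ cong (_+ Σ< r orbit) (Σ<-frob k r orbit) ⟩
    Σ< r (frob k ∘ orbit) + Σ< r orbit                 ≡⟨ sym (Σ<-+ r (frob k ∘ orbit) orbit) ⟩
    Σ< r (λ i → frob k (orbit i) + orbit i)            ≡⟨ Σ<-cong r (λ i → cong (_+ orbit i) (sym (frob-compose k (i ℕ.* k) H))) ⟩
    Σ< r (λ i → orbit (suc i) + orbit i)               ≡⟨ Σ<-telescope r orbit ⟩
    orbit r + orbit 0                                  ≡⟨ cong₂ _+_ (frob-r*k H) (frob-zero H) ⟩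
    frob e H + H                                       ≡⟨ frob[H]+H≡c ⟩
    c                                                  ∎)
    where
    orbit : ℕ → Carrier
    orbit i = frob (i ℕ.* k) H

  length-L-fibre : ∀ {x₀ c} → L x₀ ≡ c → length (filter (λ x → L x ≟ c) elements) ≡ length fixedField
  length-L-fibre {x₀} {c} L[x₀]≡c = trans
    (length-filter-involution (λ x → L x ≟ c) (λ x → solve 2 (λ x a → (x :+ a) :+ a := x) refl x x₀) unique complete)
    (cong length (filter-≐ (λ x → L (x + x₀) ≟ c) (λ x → frob e x ≟ x) (⇒fixed , fixed⇒) elements))
    where
    L[x+x₀] : ∀ x → L (x + x₀) ≡ L x + c
    L[x+x₀] x = trans (L-homo-+ x x₀) (cong (L x +_) L[x₀]≡c)
    ⇒fixed : ∀ {x} → L (x + x₀) ≡ c → frob e x ≡ x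
    ⇒fixed {x} L[x+x₀]≡c = fixed-k⇒fixed-e (x+y≡0⇒x≡y (begin
      L x                 ≡⟨ solve 2 (λ l c → l := (l :+ c) :+ c) refl (L x) c ⟩
      (L x + c) + c       ≡⟨ cong (_+ c) (trans (sym (L[x+x₀] x)) L[x+x₀]≡c) ⟩
      c + c               ≡⟨ x+x≡0 c ⟩
      0#                  ∎))
    fixed⇒ : ∀ {x} → frob e x ≡ x → L (x + x₀) ≡ c
    fixed⇒ {x} fixed = begin
      L (x + x₀)          ≡⟨ L[x+x₀] x ⟩
      L x + c             ≡⟨ cong (λ w → w + x + c) (fixed-e⇒fixed-k fixed) ⟩
      (x + x) + c         ≡⟨ cong (_+ c) (x+x≡0 x) ⟩
      0# + c              ≡⟨ +-identityˡ c ⟩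
      c                   ∎

  F : Carrier → Carrier
  F x = pow 𝔽 x (2 ℕ.^ k ℕ.+ 1)

  Δ : Carrier → Carrier → Carrier
  Δ x u = frob k x * u + frob k u * x + frob k u * u

  F-+-F : ∀ x u → F x + F (x + u) ≡ Δ x u
  F-+-F x u = begin
    F x + F (x + u)                           ≡⟨ cong₂ _+_ (F≡frob*id x) (F≡frob*id (x + u)) ⟩
    frob k x * x + frob k (x + u) * (x + u)   ≡⟨ cong (λ w → frob k x * x + w * (x + u)) (frob-homo-+ k x u) ⟩
    frob k x * x + (frob k x + frob k u) * (x + u)
      ≡⟨ solve 4 (λ X U x u → X :* x :+ (X :+ U) :* (x :+ u) := X :* u :+ U :* x :+ U :* u) refl (frob k x) (frob k u) x u ⟩
    Δ x u                                     ∎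
    where
    F≡frob*id : ∀ x → F x ≡ frob k x * x
    F≡frob*id x = trans (pow-+ x (2 ℕ.^ k) 1) (cong (frob k x *_) (*-identityʳ x))

  Δ-+1# : ∀ x u → Δ (x + 1#) u ≡ Δ x u + u + frob k u
  Δ-+1# x u = begin
    frob k (x + 1#) * u + frob k u * (x + 1#) + frob k u * u
      ≡⟨ cong (λ w → w * u + frob k u * (x + 1#) + frob k u * u) (trans (frob-homo-+ k x 1#) (cong (frob k x +_) (frob-1# k))) ⟩
    (frob k x + 1#) * u + frob k u * (x + 1#) + frob k u * u
      ≡⟨ solve 4 (λ X U x u → (X :+ con true) :* u :+ U :* (x :+ con true) :+ U :* u
                              := (X :* u :+ U :* x :+ U :* u) :+ u :+ U) refl (frob k x) (frob k u) x u ⟩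
    Δ x u + u + frob k u ∎

  module _ (b s : Carrier) (s*s≡b : s * s ≡ b) where

    System : Carrier × Carrier → Set
    System (x , y) = (F x + 1# * F y ≡ b) × (F (x + 1#) + 1# * F (y + 1#) ≡ b)

    -- With u = x + y the equations read Δ x u = b and Δ x u + u + u^{2^k} = b.
    System⇒ : ∀ {x y} → System (x , y) → x + y ≡ Tr s × b ≡ Tr s * (L x + Tr s)
    System⇒ {x} {y} (eq₁ , eq₂) = u≡Tr[s] , subst (λ w → b ≡ w * (L x + w)) u≡Tr[s] b≡u[Lx+u]
      where
      u = x + y
      Δ≡b : Δ x u ≡ b
      Δ≡b = begin
        Δ x u              ≡⟨ sym (F-+-F x u) ⟩
        F x + F (x + u)    ≡⟨ cong (λ w → F x + F w) (solve 2 (λ x y → x :+ (x :+ y) := y) refl x y) ⟩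
        F x + F y          ≡⟨ cong (F x +_) (sym (*-identityˡ _)) ⟩
        F x + 1# * F y     ≡⟨ eq₁ ⟩
        b                  ∎
      Δ+u+frob[u]≡b : Δ x u + u + frob k u ≡ b
      Δ+u+frob[u]≡b = begin
        Δ x u + u + frob k u               ≡⟨ sym (Δ-+1# x u) ⟩
        Δ (x + 1#) u                       ≡⟨ sym (F-+-F (x + 1#) u) ⟩
        F (x + 1#) + F ((x + 1#) + u)      ≡⟨ cong (λ w → F (x + 1#) + F w) (solve 3 (λ x y o → (x :+ o) :+ (x :+ y) := y :+ o) refl x y 1#) ⟩
        F (x + 1#) + F (y + 1#)            ≡⟨ cong (F (x + 1#) +_) (sym (*-identityˡ _)) ⟩
        F (x + 1#) + 1# * F (y + 1#)       ≡⟨ eq₂ ⟩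
        b                                  ∎
      frob[u]≡u : frob k u ≡ u
      frob[u]≡u = x+y≡0⇒x≡y (begin
        frob k u + u                          ≡⟨ solve 3 (λ D u U → U :+ u := ((D :+ u) :+ U) :+ D) refl (Δ x u) u (frob k u) ⟩
        (Δ x u + u + frob k u) + Δ x u        ≡⟨ cong₂ _+_ Δ+u+frob[u]≡b Δ≡b ⟩
        b + b                                 ≡⟨ x+x≡0 b ⟩
        0#                                    ∎)
      b≡u[Lx+u] : b ≡ u * (L x + u)
      b≡u[Lx+u] = begin
        b                                             ≡⟨ sym Δ≡b ⟩
        frob k x * u + frob k u * x + frob k u * u    ≡⟨ cong (λ w → frob k x * u + w * x + w * u) frob[u]≡u ⟩
        frob k x * u + u * x + u * u                  ≡⟨ solve 3 (λ X x u → X :* u :+ u :* x :+ u :* u := u :* ((X :+ x) :+ u)) refl (frob k x) x u ⟩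
        u * (L x + u)                                 ∎
      u-fixed : frob e u ≡ u
      u-fixed = fixed-k⇒fixed-e frob[u]≡u
      u≡Tr[s] : u ≡ Tr s
      u≡Tr[s] = square-injective (begin
        u * u                     ≡⟨ cong (u *_) (sym (trans (cong (_+ Tr u) (Tr-L x)) (trans (+-identityˡ _) (Tr-fixed u-fixed)))) ⟩
        u * (Tr (L x) + Tr u)     ≡⟨ cong (u *_) (sym (Tr-homo-+ (L x) u)) ⟩
        u * Tr (L x + u)          ≡⟨ sym (Tr-*ˡ u-fixed (L x + u)) ⟩
        Tr (u * (L x + u))        ≡⟨ cong Tr (sym b≡u[Lx+u]) ⟩
        Tr b                      ≡⟨ cong Tr (sym s*s≡b) ⟩
        Tr (s * s)                ≡⟨ Tr-square s ⟩
        Tr s * Tr s               ∎)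

    Tr[s]≡0⇒¬System : b ≢ 0# → Tr s ≡ 0# → ∀ {x y} → ¬ System (x , y)
    Tr[s]≡0⇒¬System b≢0 Tr[s]≡0 {x} solution =
      b≢0 (trans (proj₂ (System⇒ solution)) (trans (cong (λ t → t * (L x + t)) Tr[s]≡0) (zeroˡ _)))

    module _ (Tr[s]≢0 : Tr s ≢ 0#) where
      private
        t = Tr s
        t⁻¹ = proj₁ (inverse t Tr[s]≢0)
        tt⁻¹≡1 : t * t⁻¹ ≡ 1#
        tt⁻¹≡1 = proj₂ (inverse t Tr[s]≢0)

        t⁻¹[tw]≡w : ∀ w → t⁻¹ * (t * w) ≡ w
        t⁻¹[tw]≡w w = trans (sym (*-assoc t⁻¹ t w)) (trans (cong (_* w) (trans (*-comm t⁻¹ t) tt⁻¹≡1)) (*-identityˡ w))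

        frob[t]≡t : frob k t ≡ t
        frob[t]≡t = fixed-e⇒fixed-k (frob-Tr s)

        frob[t⁻¹]≡t⁻¹ : frob e t⁻¹ ≡ t⁻¹
        frob[t⁻¹]≡t⁻¹ = *-cancelˡ t Tr[s]≢0 (begin
          t * frob e t⁻¹          ≡⟨ cong (_* frob e t⁻¹) (sym (frob-Tr s)) ⟩
          frob e t * frob e t⁻¹   ≡⟨ sym (frob-homo-* e t t⁻¹) ⟩
          frob e (t * t⁻¹)        ≡⟨ cong (frob e) tt⁻¹≡1 ⟩
          frob e 1#               ≡⟨ trans (frob-1# e) (sym tt⁻¹≡1) ⟩
          t * t⁻¹                 ∎)

      c : Carrier
      c = t⁻¹ * b + t

      Tr[c]≡0 : Tr c ≡ 0#
      Tr[c]≡0 = begin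
        Tr (t⁻¹ * b + t)         ≡⟨ Tr-homo-+ (t⁻¹ * b) t ⟩
        Tr (t⁻¹ * b) + Tr t      ≡⟨ cong₂ _+_ (Tr-*ˡ frob[t⁻¹]≡t⁻¹ b) (Tr-fixed (frob-Tr s)) ⟩
        t⁻¹ * Tr b + t           ≡⟨ cong (λ w → t⁻¹ * Tr w + t) (sym s*s≡b) ⟩
        t⁻¹ * Tr (s * s) + t     ≡⟨ cong (λ w → t⁻¹ * w + t) (Tr-square s) ⟩
        t⁻¹ * (t * t) + t        ≡⟨ cong (_+ t) (t⁻¹[tw]≡w t) ⟩
        t + t                    ≡⟨ x+x≡0 t ⟩
        0#                       ∎

      System⇒graph : ∀ {x y} → System (x , y) → y ≡ x + t × L x ≡ c
      System⇒graph {x} {y} solution = trans (solve 2 (λ x y → y := x :+ (x :+ y)) refl x y) (cong (x +_) x+y≡t) , (begin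
        L x                       ≡⟨ solve 2 (λ l t → l := (l :+ t) :+ t) refl (L x) t ⟩
        (L x + t) + t             ≡⟨ cong (_+ t) (sym (t⁻¹[tw]≡w (L x + t))) ⟩
        t⁻¹ * (t * (L x + t)) + t ≡⟨ cong (λ w → t⁻¹ * w + t) (sym b≡t[Lx+t]) ⟩
        c                         ∎)
        where
        x+y≡t = proj₁ (System⇒ solution)
        b≡t[Lx+t] = proj₂ (System⇒ solution)

      graph⇒System : ∀ {x} → L x ≡ c → System (x , x + t)
      graph⇒System {x} L[x]≡c = eq₁ , eq₂
        where
        Δ≡b : Δ x t ≡ b
        Δ≡b = begin
          frob k x * t + frob k t * x + frob k t * t ≡⟨ cong (λ w → frob k x * t + w * x + w * t) frob[t]≡t ⟩
          frob k x * t + t * x + t * t               ≡⟨ solve 3 (λ X x t → X :* t :+ t :* x :+ t :* t := t :* ((X :+ x) :+ t)) refl (frob k x) x t ⟩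
          t * (L x + t)                              ≡⟨ cong (λ w → t * (w + t)) L[x]≡c ⟩
          t * ((t⁻¹ * b + t) + t)                    ≡⟨ cong (t *_) (solve 2 (λ a t → (a :+ t) :+ t := a) refl (t⁻¹ * b) t) ⟩
          t * (t⁻¹ * b)                              ≡⟨ sym (*-assoc t t⁻¹ b) ⟩
          (t * t⁻¹) * b                              ≡⟨ trans (cong (_* b) tt⁻¹≡1) (*-identityˡ b) ⟩
          b                                          ∎
        eq₁ : F x + 1# * F (x + t) ≡ b
        eq₁ = trans (cong (F x +_) (*-identityˡ _)) (trans (F-+-F x t) Δ≡b)
        eq₂ : F (x + 1#) + 1# * F ((x + t) + 1#) ≡ b
        eq₂ = begin
          F (x + 1#) + 1# * F ((x + t) + 1#)  ≡⟨ cong (F (x + 1#) +_) (*-identityˡ _) ⟩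
          F (x + 1#) + F ((x + t) + 1#)       ≡⟨ cong (λ w → F (x + 1#) + F w) (solve 3 (λ x t o → (x :+ t) :+ o := (x :+ o) :+ t) refl x t 1#) ⟩
          F (x + 1#) + F ((x + 1#) + t)       ≡⟨ trans (F-+-F (x + 1#) t) (Δ-+1# x t) ⟩
          Δ x t + t + frob k t                ≡⟨ cong₂ (λ a w → a + t + w) Δ≡b frob[t]≡t ⟩
          b + t + t                           ≡⟨ solve 2 (λ b t → b :+ t :+ t := b) refl b t ⟩
          b                                   ∎

  boomerang-entry : .{{_ : ℕ.NonZero e}} → ∀ b → b ≢ 0# → ∀ s → s * s ≡ b →
                    (Tr s ≡ 0# → cBCT 𝔽 F 1# 1# 1# b ≡ 0) × (Tr s ≢ 0# → cBCT 𝔽 F 1# 1# 1# b ≡ 2 ℕ.^ e)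
  boomerang-entry b b≢0 s s*s≡b = none , count
    where
    none : Tr s ≡ 0# → cBCT 𝔽 F 1# 1# 1# b ≡ 0
    none Tr[s]≡0 = cong length (filter-none _
      (All.universal (λ { (x , y) → Tr[s]≡0⇒¬System b s s*s≡b b≢0 Tr[s]≡0 }) (cartesianProduct elements elements)))
    count : Tr s ≢ 0# → cBCT 𝔽 F 1# 1# 1# b ≡ 2 ℕ.^ e
    count Tr[s]≢0 = begin
      cBCT 𝔽 F 1# 1# 1# b                              ≡⟨ length-filter-cartesianProduct-graph _≟_ unique complete _ (λ x → L x ≟ c′) (_+ Tr s)
                                                             (System⇒graph b s s*s≡b Tr[s]≢0) (graph⇒System b s s*s≡b Tr[s]≢0) elements ⟩
      length (filter (λ x → L x ≟ c′) elements)        ≡⟨ length-L-fibre (proj₂ (L-preimage c′ (Tr[c]≡0 b s s*s≡b Tr[s]≢0))) ⟩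
      length fixedField                                ≡⟨ length-fixedField ⟩
      2 ℕ.^ e                                          ∎
      where
      c′ = c b s s*s≡b Tr[s]≢0

suc[2*[d/2]]≡d : ∀ d → d % 2 ≡ 1 → suc (2 ℕ.* (d / 2)) ≡ d
suc[2*[d/2]]≡d d d%2≡1 = sym (trans (m≡m%n+[m/n]*n d 2) (cong₂ ℕ._+_ d%2≡1 (ℕ.*-comm (d / 2) 2)))

open import Data.Nat using (_+_; _*_; _^_)

mainTheorem1 :
    ∀ (n k : ℕ) → 2 ≤ n → 1 ≤ k → k < n →
    ∀ (d : ℕ) → d * gcd k n ≡ n → d % 2 ≡ 1 →
    (𝔽 : FiniteField n) →
    ∀ (b : FiniteField.Carrier 𝔽) → ¬ (b ≡ FiniteField.0# 𝔽) →
    ∀ (s : FiniteField.Carrier 𝔽) → FiniteField._*_ 𝔽 s s ≡ b →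
    let B = cBCT 𝔽 (λ x → pow 𝔽 x (2 ^ k + 1)) (FiniteField.1# 𝔽) (FiniteField.1# 𝔽) (FiniteField.1# 𝔽) b in
    (relTrace 𝔽 (gcd k n) d s ≡ FiniteField.0# 𝔽 → B ≡ 0) ×
    (¬ (relTrace 𝔽 (gcd k n) d s ≡ FiniteField.0# 𝔽) → B ≡ 2 ^ gcd k n)
mainTheorem1 n k 2≤n 1≤k _ d d*e≡n d%2≡1 𝔽 b b≢0 s s*s≡b =
  subst (λ d → (relTrace 𝔽 e d s ≡ 0# → B ≡ 0) × (¬ (relTrace 𝔽 e d s ≡ 0#) → B ≡ 2 ^ e)) 2h+1≡d
    (GoldBoomerang.boomerang-entry 𝔽 k e h (subst (λ d → d * e ≡ n) (sym 2h+1≡d) d*e≡n)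
      (gcd[m,n]∣m k n) (Bézout.identity (gcd-GCD k n)) b b≢0 s s*s≡b)
  where
  open FiniteField 𝔽 using (0#; 1#)
  e = gcd k n
  h = d / 2
  B = cBCT 𝔽 (λ x → pow 𝔽 x (2 ^ k + 1)) 1# 1# 1# b
  2h+1≡d : suc (2 * h) ≡ d
  2h+1≡d = suc[2*[d/2]]≡d d d%2≡1
  instance
    n≢0 : ℕ.NonZero n
    n≢0 = ℕ.>-nonZero (ℕ.≤-trans (s≤s z≤n) 2≤n)
    e≢0 : ℕ.NonZero e
    e≢0 = ℕ.≢-nonZero (gcd[m,n]≢0 k n (inj₁ (ℕ.≢-nonZero⁻¹ k {{ℕ.>-nonZero 1≤k}})))
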